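{- Let $S,m,x,y$ be real numbers with $S,m,x\neq 0$ such that $p_1(S,m,x,y)=0$ and $p_2(S,m,x,y)=0$, and put $z=\frac{x(m+1)-S(S+1)}{2S}$. Then $S=x+z^2$, $m=(x+z^2+z)^2/x$, and $y=y_1$ or $y=y_2$, where $y_1=x-z$ and $$y_2=\frac{x^3+2x^2z^2+x^2z+xz^4+2xz^3+3xz^2+z^5+2z^4+z^3}{(x+z^2+z)^2}.$$ Moreover, if $S_0,m_0,x_0,y_0$ are nonzero integers with $p_1(S_0,m_0,x_0,y_0)=p_2(S_0,m_0,x_0,y_0)=0$, then $z_0=\frac{x_0(m_0+1)-S_0(S_0+1)}{2S_0}$ is an integer.
   Context: $p_1(S,m,x,y)= S^4 - 2S^2xm + x^2m^2 - 2S^3 + 2S^2x - 2Sxm + 2x^2m + S^2 - 2Sx + x^2$ and $p_2(S,m,x,y)= S^4 + 2S^2xm - 4S^2ym + x^2m^2 - 4xym^2 + 4y^2m^2 - 2S^3 + 2S^2x + 8S^2m - 6Sxm - 2x^2m- 4Sym + 4xym - 4Sm^2 + 4xm^2 + S^2 - 2Sx + x^2$. -}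

module Defs where

open import Level using (0ℓ)
open import Data.Nat using (ℕ)
open import Data.Product using (∃; _×_)
open import Data.Sum using (_⊎_)
open import Relation.Nullary using (¬_)
open import Relation.Binary.Core using (Rel)
open import Relation.Binary.Definitions using (_Respects₂_)
open import Algebra.Bundles using (CommutativeRing; Semiring)
import Algebra.Definitions.RawSemiring as RS

module Polys {c ℓ} (R : CommutativeRing c ℓ) where
  open CommutativeRing R
  open RS (Semiring.rawSemiring semiring) using (_^_) renaming (_×_ to _·_)

  p₁ : Carrier → Carrier → Carrier → Carrier → Carrier
  p₁ S m x y =
    S ^ 4 - 2 · (S ^ 2 * x * m) + x ^ 2 * m ^ 2 - 2 · (S ^ 3) + 2 · (S ^ 2 * x)
    - 2 · (S * x * m) + 2 · (x ^ 2 * m) + S ^ 2 - 2 · (S * x) + x ^ 2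

  p₂ : Carrier → Carrier → Carrier → Carrier → Carrier
  p₂ S m x y =
    S ^ 4 + 2 · (S ^ 2 * x * m) - 4 · (S ^ 2 * y * m) + x ^ 2 * m ^ 2
    - 4 · (x * y * m ^ 2) + 4 · (y ^ 2 * m ^ 2) - 2 · (S ^ 3) + 2 · (S ^ 2 * x)
    + 8 · (S ^ 2 * m) - 6 · (S * x * m) - 2 · (x ^ 2 * m) - 4 · (S * y * m)
    + 4 · (x * y * m) - 4 · (S * m ^ 2) + 4 · (x * m ^ 2) + S ^ 2 - 2 · (S * x) + x ^ 2

-- The real numbers, axiomatised as a (Dedekind-)complete ordered field
-- (any model is isomorphic to ℝ).
record RealField : Set₁ where
  field
    commRing : CommutativeRing 0ℓ 0ℓ
  open CommutativeRing commRing public hiding (ring)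
  open RS (Semiring.rawSemiring semiring) public using (_^_) renaming (_×_ to _·_)
  field
    _<_        : Rel Carrier 0ℓ
    <-resp-≈   : _<_ Respects₂ _≈_
    0≉1        : ¬ (0# ≈ 1#)
    inverse    : ∀ a → ¬ (a ≈ 0#) → ∃ λ b → a * b ≈ 1#
    <-irrefl   : ∀ a → ¬ (a < a)
    <-trans    : ∀ {a b c} → a < b → b < c → a < c
    <-trichot  : ∀ a b → (a < b) ⊎ ((a ≈ b) ⊎ (b < a))
    +-mono-<   : ∀ {a b} c → a < b → (a + c) < (b + c)
    *-pos      : ∀ {a b} → 0# < a → 0# < b → 0# < (a * b)

  _≤_ : Rel Carrier 0ℓ
  a ≤ b = (a < b) ⊎ (a ≈ b)

  field
    sup : (P : Carrier → Set) → ∃ P → (∃ λ u → ∀ a → P a → a ≤ u) →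
          ∃ λ s → (∀ a → P a → a ≤ s) × (∀ u → (∀ a → P a → a ≤ u) → s ≤ u)

{-# OPTIONS --safe #-}
module Submission where

-- Put num = x(m+1) − S(S+1) and den = 2S, so that z = num / den. The identity
-- p₁ = num² − den² (S − x) says that p₁ = 0 means exactly S = x + z². Modulo
-- S − (x + z²) and den z − num the difference m x − (x + z² + z)² vanishes, and
-- x² p₂, which depends on m only through m x, then factors as
-- 4 q² (y − (x − z)) (y q² − N) with q = x + z² + z and N the numerator of y₂.
-- An ordered field has characteristic 0 and no zero divisors, which gives the real
-- statement. Over ℤ the same identity shows (2S)² ∣ num², hence 2S ∣ num.

open import Defs
open import Algebra.Bundles using (CommutativeRing; Semiring)
open import Algebra.Solver.Ring.AlmostCommutativeRing
  using (fromCommutativeRing; _-Raw-AlmostCommutative⟶_; Induced-equivalence)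
import Algebra.Definitions.RawSemiring as RawSemiringDefinitions
open import Data.Empty using (⊥-elim)
open import Data.Fin using (#_)
open import Data.Integer as Z using (ℤ; +_; -[1+_]; _⊖_; _◃_; 0ℤ; 1ℤ)
import Data.Integer.Properties as ZP
open import Data.Integer.Properties using (+-*-commutativeRing)
open import Data.Maybe using (just; nothing)
open import Data.Nat as ℕ using (ℕ; zero; suc)
import Data.Nat.Properties as ℕ using (+-suc)
import Data.Nat.Divisibility as ℕ using (_∣_)
open import Data.Product using (_×_; _,_; proj₁; proj₂)
import Data.Sign as Sign
open import Data.Sum as Sum using (_⊎_; inj₁; inj₂)
open import Data.Vec using ([]; _∷_)
open import Data.Vec.Relation.Binary.Pointwise.Inductive as Pointwise using (Pointwise; _∷_; [])
open import Function using (_∘_)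
open import Relation.Binary.Definitions using (WeaklyDecidable; Decidable)
open import Relation.Binary.PropositionalEquality as ≡ using (_≡_)
open import Relation.Nullary using (¬_; yes; no)

module SquareDivisibility where
  open import Data.Nat
  open import Data.Nat.Properties using (*-identityˡ; m*n≢0; m*n≢0⇒n≢0)
  open import Data.Nat.Divisibility using (_∣_; divides-refl; ∣-trans; m∣m*n; *-monoˡ-∣; *-cancelʳ-∣)
  open import Data.Nat.GCD using (gcd; gcd-GCD; gcd[m,n]∣m; gcd[m,n]∣n; GCD; GCD-*)
  open import Data.Nat.Coprimality as Coprime using (Coprime; GCD≡1⇒coprime; coprime-divisor)
  open import Data.Nat.Tactic.RingSolver using (solve-∀)
  open import Relation.Binary.PropositionalEquality using (_≡_; sym; subst; subst₂)

  m*m∣n*n⇒m∣n : ∀ m n .{{_ : NonZero m}} → m * m ∣ n * n → m ∣ n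
  m*m∣n*n⇒m∣n m n mm∣nn with gcd n m | gcd-GCD n m | gcd[m,n]∣m n m | gcd[m,n]∣n n m
  ... | g | gcd[n,m]≡g | divides-refl n′ | divides-refl m′ =
    *-monoˡ-∣ g (coprime-divisor (Coprime.sym coprime) m′∣n′*n′)
    where
    instance
      g≢0 : NonZero g
      g≢0 = m*n≢0⇒n≢0 m′
      g*g≢0 : NonZero (g * g)
      g*g≢0 = m*n≢0 g g

    coprime : Coprime n′ m′
    coprime = GCD≡1⇒coprime (GCD-* (subst (GCD (n′ * g) (m′ * g)) (sym (*-identityˡ g)) gcd[n,m]≡g))

    rearrange : ∀ a b → a * b * (a * b) ≡ a * a * (b * b)
    rearrange = solve-∀

    m′∣n′*n′ : m′ ∣ n′ * n′
    m′∣n′*n′ = ∣-trans (m∣m*n m′) (*-cancelʳ-∣ (g * g) (subst₂ _∣_ (rearrange m′ g) (rearrange n′ g) mm∣nn))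

-- The canonical map ℤ → R lets Algebra.Solver.Ring prove identities of R with
-- integer coefficients (its coefficients need a decidable equality).
module IntegerCoefficients {c ℓ} (R : CommutativeRing c ℓ) where
  open CommutativeRing R
  open import Algebra.Properties.Ring ring
  open import Algebra.Properties.Semiring.Mult.TCOptimised semiring using (×-homo-+; ×1-homo-*) renaming (_×_ to _×′_)
  open import Relation.Binary.Reasoning.Setoid setoid

  fromℕ : ℕ → Carrier
  fromℕ n = n ×′ 1#

  fromℕ-suc : ∀ n → fromℕ (suc n) ≈ 1# + fromℕ n
  fromℕ-suc = ×-homo-+ 1# 1

  fromℕ-homo-+ : ∀ m n → fromℕ (m ℕ.+ n) ≈ fromℕ m + fromℕ n
  fromℕ-homo-+ = ×-homo-+ 1#

  fromℕ-homo-* : ∀ m n → fromℕ (m ℕ.* n) ≈ fromℕ m * fromℕ n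
  fromℕ-homo-* = ×1-homo-*

  fromℤ : ℤ → Carrier
  fromℤ (+ n)    = fromℕ n
  fromℤ -[1+ n ] = - fromℕ (suc n)

  fromℤ-⊖ : ∀ m n → fromℤ (m ⊖ n) ≈ fromℕ m - fromℕ n
  fromℤ-⊖ m       zero    = sym (trans (+-congˡ -0#≈0#) (+-identityʳ _))
  fromℤ-⊖ zero    (suc n) = sym (+-identityˡ _)
  fromℤ-⊖ (suc m) (suc n) = begin
    fromℤ (suc m ⊖ suc n)                    ≡⟨ ≡.cong fromℤ (ZP.[1+m]⊖[1+n]≡m⊖n m n) ⟩
    fromℤ (m ⊖ n)                            ≈⟨ fromℤ-⊖ m n ⟩
    fromℕ m - fromℕ n                        ≈⟨ xyx⁻¹≈y 1# (fromℕ m - fromℕ n) ⟨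
    1# + (fromℕ m - fromℕ n) - 1#            ≈⟨ +-congʳ (+-assoc 1# _ _) ⟨
    1# + fromℕ m - fromℕ n - 1#              ≈⟨ +-assoc _ _ _ ⟩
    1# + fromℕ m + (- fromℕ n - 1#)          ≈⟨ +-congˡ (-‿anti-homo-+ 1# (fromℕ n)) ⟨
    1# + fromℕ m - (1# + fromℕ n)            ≈⟨ +-cong (fromℕ-suc m) (-‿cong (fromℕ-suc n)) ⟨
    fromℕ (suc m) - fromℕ (suc n)            ∎

  fromℤ-homo-+ : ∀ i j → fromℤ (i Z.+ j) ≈ fromℤ i + fromℤ j
  fromℤ-homo-+ (+ m)    (+ n)    = fromℕ-homo-+ m n
  fromℤ-homo-+ (+ m)    -[1+ n ] = fromℤ-⊖ m (suc n)
  fromℤ-homo-+ -[1+ m ] (+ n)    = trans (fromℤ-⊖ n (suc m)) (+-comm _ _)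
  fromℤ-homo-+ -[1+ m ] -[1+ n ] = begin
    - fromℕ (suc (suc (m ℕ.+ n)))            ≡⟨ ≡.cong (λ k → - fromℕ (suc k)) (ℕ.+-suc m n) ⟨
    - fromℕ (suc m ℕ.+ suc n)                ≈⟨ -‿cong (fromℕ-homo-+ (suc m) (suc n)) ⟩
    - (fromℕ (suc m) + fromℕ (suc n))        ≈⟨ -‿+-comm _ _ ⟨
    - fromℕ (suc m) - fromℕ (suc n)          ∎

  fromℤ-pos◃ : ∀ n → fromℤ (Sign.+ ◃ n) ≈ fromℕ n
  fromℤ-pos◃ zero    = refl
  fromℤ-pos◃ (suc n) = refl

  fromℤ-neg◃ : ∀ n → fromℤ (Sign.- ◃ n) ≈ - fromℕ n
  fromℤ-neg◃ zero    = sym -0#≈0#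
  fromℤ-neg◃ (suc n) = refl

  fromℤ-homo-* : ∀ i j → fromℤ (i Z.* j) ≈ fromℤ i * fromℤ j
  fromℤ-homo-* (+ m)    (+ n)    = trans (fromℤ-pos◃ (m ℕ.* n)) (fromℕ-homo-* m n)
  fromℤ-homo-* (+ m)    -[1+ n ] = begin
    fromℤ (Sign.- ◃ m ℕ.* suc n)             ≈⟨ fromℤ-neg◃ (m ℕ.* suc n) ⟩
    - fromℕ (m ℕ.* suc n)                    ≈⟨ -‿cong (fromℕ-homo-* m (suc n)) ⟩
    - (fromℕ m * fromℕ (suc n))              ≈⟨ -‿distribʳ-* _ _ ⟩
    fromℕ m * - fromℕ (suc n)                ∎
  fromℤ-homo-* -[1+ m ] (+ n)    = begin
    fromℤ (Sign.- ◃ suc m ℕ.* n)             ≈⟨ fromℤ-neg◃ (suc m ℕ.* n) ⟩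
    - fromℕ (suc m ℕ.* n)                    ≈⟨ -‿cong (fromℕ-homo-* (suc m) n) ⟩
    - (fromℕ (suc m) * fromℕ n)              ≈⟨ -‿distribˡ-* _ _ ⟩
    - fromℕ (suc m) * fromℕ n                ∎
  fromℤ-homo-* -[1+ m ] -[1+ n ] = begin
    fromℕ (suc m ℕ.* suc n)                  ≈⟨ fromℕ-homo-* (suc m) (suc n) ⟩
    fromℕ (suc m) * fromℕ (suc n)            ≈⟨ -‿involutive _ ⟨
    - - (fromℕ (suc m) * fromℕ (suc n))      ≈⟨ -‿cong (-‿distribˡ-* _ _) ⟩
    - (- fromℕ (suc m) * fromℕ (suc n))      ≈⟨ -‿distribʳ-* _ _ ⟩
    - fromℕ (suc m) * - fromℕ (suc n)        ∎

  fromℤ-homo-neg : ∀ i → fromℤ (Z.- i) ≈ - fromℤ i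
  fromℤ-homo-neg (+ zero)  = sym -0#≈0#
  fromℤ-homo-neg (+ suc n) = refl
  fromℤ-homo-neg -[1+ n ]  = sym (-‿involutive _)

  fromℤ-morphism : Z.+-*-rawRing -Raw-AlmostCommutative⟶ fromCommutativeRing R
  fromℤ-morphism = record
    { ⟦_⟧    = fromℤ
    ; +-homo = fromℤ-homo-+
    ; *-homo = fromℤ-homo-*
    ; -‿homo = fromℤ-homo-neg
    ; 0-homo = refl
    ; 1-homo = refl
    }

  _≟ᶜ_ : WeaklyDecidable (Induced-equivalence fromℤ-morphism)
  i ≟ᶜ j with i Z.≟ j
  ... | yes ≡.refl = just refl
  ... | no _       = nothing

  open import Algebra.Solver.Ring Z.+-*-rawRing (fromCommutativeRing R) fromℤ-morphism _≟ᶜ_ public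

  open import Algebra.Properties.Semiring.Exp semiring using (^-congˡ)

  ⟦⟧-cong : ∀ {n} (p : Polynomial n) {ρ σ} → Pointwise _≈_ ρ σ → ⟦ p ⟧ ρ ≈ ⟦ p ⟧ σ
  ⟦⟧-cong (op [+] p q) ρ≈σ = +-cong (⟦⟧-cong p ρ≈σ) (⟦⟧-cong q ρ≈σ)
  ⟦⟧-cong (op [*] p q) ρ≈σ = *-cong (⟦⟧-cong p ρ≈σ) (⟦⟧-cong q ρ≈σ)
  ⟦⟧-cong (con c)      ρ≈σ = refl
  ⟦⟧-cong (var i)      ρ≈σ = Pointwise.lookup ρ≈σ i
  ⟦⟧-cong (p :^ k)     ρ≈σ = ^-congˡ k (⟦⟧-cong p ρ≈σ)
  ⟦⟧-cong (:- p)       ρ≈σ = -‿cong (⟦⟧-cong p ρ≈σ)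

module PolynomialIdentities {c ℓ} (R : CommutativeRing c ℓ) where
  open CommutativeRing R
  open RawSemiringDefinitions (Semiring.rawSemiring semiring) using (_^_) renaming (_×_ to _·_)
  open import Algebra.Properties.Ring ring using (x≈y⇒x∙y⁻¹≈ε)
  open import Relation.Binary.Reasoning.Setoid setoid
  open Polys R
  open IntegerCoefficients R

  num : Carrier → Carrier → Carrier → Carrier
  num S m x = x * (m + 1#) - S * (S + 1#)

  den : Carrier → Carrier
  den S = 2 · S

  q : Carrier → Carrier → Carrier
  q x z = x + z ^ 2 + z

  y₂-numerator : Carrier → Carrier → Carrier
  y₂-numerator x z =
    x ^ 3 + 2 · (x ^ 2 * z ^ 2) + x ^ 2 * z + x * z ^ 4
    + 2 · (x * z ^ 3) + 3 · (x * z ^ 2)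
    + z ^ 5 + 2 · (z ^ 4) + z ^ 3

  private
    variable n : ℕ

    1ᴾ : Polynomial n
    1ᴾ = con 1ℤ

    p₁ᴾ p₂ᴾ : Polynomial n → Polynomial n → Polynomial n → Polynomial n → Polynomial n
    p₁ᴾ S m x y =
      S :^ 4 :- 2 :× (S :^ 2 :* x :* m) :+ x :^ 2 :* m :^ 2 :- 2 :× (S :^ 3) :+ 2 :× (S :^ 2 :* x)
      :- 2 :× (S :* x :* m) :+ 2 :× (x :^ 2 :* m) :+ S :^ 2 :- 2 :× (S :* x) :+ x :^ 2
    p₂ᴾ S m x y =
      S :^ 4 :+ 2 :× (S :^ 2 :* x :* m) :- 4 :× (S :^ 2 :* y :* m) :+ x :^ 2 :* m :^ 2
      :- 4 :× (x :* y :* m :^ 2) :+ 4 :× (y :^ 2 :* m :^ 2) :- 2 :× (S :^ 3) :+ 2 :× (S :^ 2 :* x)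
      :+ 8 :× (S :^ 2 :* m) :- 6 :× (S :* x :* m) :- 2 :× (x :^ 2 :* m) :- 4 :× (S :* y :* m)
      :+ 4 :× (x :* y :* m) :- 4 :× (S :* m :^ 2) :+ 4 :× (x :* m :^ 2) :+ S :^ 2 :- 2 :× (S :* x) :+ x :^ 2

    numᴾ : Polynomial n → Polynomial n → Polynomial n → Polynomial n
    numᴾ S m x = x :* (m :+ 1ᴾ) :- S :* (S :+ 1ᴾ)

    qᴾ : Polynomial n → Polynomial n → Polynomial n
    qᴾ x z = x :+ z :^ 2 :+ z

    y₂-numeratorᴾ : Polynomial n → Polynomial n → Polynomial n
    y₂-numeratorᴾ x z =
      x :^ 3 :+ 2 :× (x :^ 2 :* z :^ 2) :+ x :^ 2 :* z :+ x :* z :^ 4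
      :+ 2 :× (x :* z :^ 3) :+ 3 :× (x :* z :^ 2)
      :+ z :^ 5 :+ 2 :× (z :^ 4) :+ z :^ 3

    -- x² p₂(S, m, x, y) only involves m through M = m x.
    x²p₂ᴾ : Polynomial n → Polynomial n → Polynomial n → Polynomial n → Polynomial n
    x²p₂ᴾ S M x y =
      S :^ 4 :* x :^ 2 :+ 2 :× (S :^ 2 :* x :^ 2 :* M) :- 4 :× (S :^ 2 :* y :* x :* M) :+ x :^ 2 :* M :^ 2
      :- 4 :× (y :* x :* M :^ 2) :+ 4 :× (y :^ 2 :* M :^ 2) :- 2 :× (S :^ 3 :* x :^ 2) :+ 2 :× (S :^ 2 :* x :^ 3)
      :+ 8 :× (S :^ 2 :* x :* M) :- 6 :× (S :* x :^ 2 :* M) :- 2 :× (x :^ 3 :* M) :- 4 :× (S :* y :* x :* M)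
      :+ 4 :× (y :* x :^ 2 :* M) :- 4 :× (S :* M :^ 2) :+ 4 :× (x :* M :^ 2) :+ S :^ 2 :* x :^ 2
      :- 2 :× (S :* x :^ 3) :+ x :^ 4

  x²p₂ : Carrier → Carrier → Carrier → Carrier → Carrier
  x²p₂ S M x y = ⟦ x²p₂ᴾ (var (# 0)) (var (# 1)) (var (# 2)) (var (# 3)) ⟧ (S ∷ M ∷ x ∷ y ∷ [])

  x²p₂-cong : ∀ {S S′ M M′} x y → S ≈ S′ → M ≈ M′ → x²p₂ S M x y ≈ x²p₂ S′ M′ x y
  x²p₂-cong x y S≈S′ M≈M′ = ⟦⟧-cong (x²p₂ᴾ (var (# 0)) (var (# 1)) (var (# 2)) (var (# 3))) (S≈S′ ∷ M≈M′ ∷ refl ∷ refl ∷ [])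

  2·x≈[1+1]*x : ∀ x → 2 · x ≈ (1# + 1#) * x
  2·x≈[1+1]*x = solve 1 (λ x → 2 :× x := (1ᴾ :+ 1ᴾ) :* x) refl

  p₁≈num²-den²[S-x] : ∀ S m x y → p₁ S m x y ≈ num S m x * num S m x - den S * den S * (S - x)
  p₁≈num²-den²[S-x] = solve 4 (λ S m x y →
    p₁ᴾ S m x y := numᴾ S m x :* numᴾ S m x :- (2 :× S) :* (2 :× S) :* (S :- x)) refl

  x²p₂≈x²p₂[S,mx] : ∀ S m x y → x * x * p₂ S m x y ≈ x²p₂ S (m * x) x y
  x²p₂≈x²p₂[S,mx] = solve 4 (λ S m x y → x :* x :* p₂ᴾ S m x y := x²p₂ᴾ S (m :* x) x y) refl

  x²p₂-factorisation : ∀ x y z →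
    x²p₂ (x + z ^ 2) (q x z ^ 2) x y ≈ 2 · (2 · (q x z ^ 2 * ((y - (x - z)) * (y * q x z ^ 2 - y₂-numerator x z))))
  x²p₂-factorisation = solve 3 (λ x y z →
    x²p₂ᴾ (x :+ z :^ 2) (qᴾ x z :^ 2) x y
      := 2 :× (2 :× (qᴾ x z :^ 2 :* ((y :- (x :- z)) :* (y :* qᴾ x z :^ 2 :- y₂-numeratorᴾ x z))))) refl

  den²[x+z²-S]≈p₁ : ∀ {S m x z} y → den S * z ≈ num S m x → den S * den S * (x + z ^ 2 - S) ≈ p₁ S m x y
  den²[x+z²-S]≈p₁ {S} {m} {x} {z} y dz≈num = begin
    den S * den S * (x + z ^ 2 - S)                         ≈⟨ complete S x z ⟩
    den S * z * (den S * z) - den S * den S * (S - x)       ≈⟨ +-congʳ (*-cong dz≈num dz≈num) ⟩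
    num S m x * num S m x - den S * den S * (S - x)         ≈⟨ p₁≈num²-den²[S-x] S m x y ⟨
    p₁ S m x y                                              ∎
    where
    complete : ∀ S x z → den S * den S * (x + z ^ 2 - S) ≈ den S * z * (den S * z) - den S * den S * (S - x)
    complete = solve 3 (λ S x z →
      (2 :× S) :* (2 :× S) :* (x :+ z :^ 2 :- S) := (2 :× S) :* z :* ((2 :× S) :* z) :- (2 :× S) :* (2 :× S) :* (S :- x)) refl

  m*x≈q² : ∀ {S m x z} → den S * z ≈ num S m x → S ≈ x + z ^ 2 → m * x ≈ q x z ^ 2
  m*x≈q² {S} {m} {x} {z} dz≈num S≈x+z² = begin
    m * x
      ≈⟨ expand S m x z ⟩
    q x z ^ 2 + (num S m x - den S * z) + (S - (x + z ^ 2)) * w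
      ≈⟨ +-cong (+-congˡ (x≈y⇒x∙y⁻¹≈ε (sym dz≈num))) (*-congʳ (x≈y⇒x∙y⁻¹≈ε S≈x+z²)) ⟩
    q x z ^ 2 + 0# + 0# * w
      ≈⟨ trans (+-cong (+-identityʳ _) (zeroˡ w)) (+-identityʳ _) ⟩
    q x z ^ 2
      ∎
    where
    w : Carrier
    w = 2 · z + x + z ^ 2 + S + 1#
    expand : ∀ S m x z → m * x ≈ q x z ^ 2 + (num S m x - den S * z) + (S - (x + z ^ 2)) * (2 · z + x + z ^ 2 + S + 1#)
    expand = solve 4 (λ S m x z →
      m :* x := qᴾ x z :^ 2 :+ (numᴾ S m x :- (2 :× S) :* z) :+ (S :- (x :+ z :^ 2)) :* (2 :× z :+ x :+ z :^ 2 :+ S :+ 1ᴾ)) refl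

  x²p₂≈4q²[y-y₁][yq²-y₂] : ∀ {S m x z} y → S ≈ x + z ^ 2 → m * x ≈ q x z ^ 2 →
    x * x * p₂ S m x y ≈ 2 · (2 · (q x z ^ 2 * ((y - (x - z)) * (y * q x z ^ 2 - y₂-numerator x z))))
  x²p₂≈4q²[y-y₁][yq²-y₂] {S} {m} {x} {z} y S≈x+z² mx≈q² =
    trans (x²p₂≈x²p₂[S,mx] S m x y) (trans (x²p₂-cong x y S≈x+z² mx≈q²) (x²p₂-factorisation x y z))

module OrderedFieldProperties (ℝ : RealField) where
  open RealField ℝ
  open import Algebra.Properties.Ring (CommutativeRing.ring commRing)
    using (-1*x≈-x; -‿involutive)
  open import Relation.Binary.Reasoning.Setoid setoid
  open PolynomialIdentities commRing using (2·x≈[1+1]*x)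

  <⇒≉ : ∀ {a b} → a < b → ¬ (a ≈ b)
  <⇒≉ {a} {b} a<b a≈b = <-irrefl b (proj₂ <-resp-≈ a≈b a<b)

  _≟_ : Decidable _≈_
  a ≟ b with <-trichot a b
  ... | inj₁ a<b        = no (<⇒≉ a<b)
  ... | inj₂ (inj₁ a≈b) = yes a≈b
  ... | inj₂ (inj₂ b<a) = no (<⇒≉ b<a ∘ sym)

  0<1 : 0# < 1#
  0<1 with <-trichot 0# 1#
  ... | inj₁ 0<1        = 0<1
  ... | inj₂ (inj₁ 0≈1) = ⊥-elim (0≉1 0≈1)
  ... | inj₂ (inj₂ 1<0) = ⊥-elim (<-irrefl 0# (<-trans (proj₁ <-resp-≈ [-1]*[-1]≈1 (*-pos 0<-1 0<-1)) 1<0))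
    where
    0<-1 : 0# < (- 1#)
    0<-1 = proj₂ <-resp-≈ (-‿inverseʳ 1#) (proj₁ <-resp-≈ (+-identityˡ _) (+-mono-< (- 1#) 1<0))
    [-1]*[-1]≈1 : - 1# * - 1# ≈ 1#
    [-1]*[-1]≈1 = trans (-1*x≈-x (- 1#)) (-‿involutive 1#)

  1+1≉0 : ¬ (1# + 1# ≈ 0#)
  1+1≉0 = <⇒≉ 0<1+1 ∘ sym
    where
    0<1+1 : 0# < (1# + 1#)
    0<1+1 = <-trans 0<1 (proj₂ <-resp-≈ (+-identityˡ 1#) (+-mono-< 1# 0<1))

  x*y≈0⇒y≈0 : ∀ {a b} → ¬ (a ≈ 0#) → a * b ≈ 0# → b ≈ 0#
  x*y≈0⇒y≈0 {a} {b} a≉0 ab≈0 with inverse a a≉0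
  ... | a⁻¹ , aa⁻¹≈1 = begin
    b              ≈⟨ *-identityˡ b ⟨
    1# * b         ≈⟨ *-congʳ (trans (sym aa⁻¹≈1) (*-comm a a⁻¹)) ⟩
    a⁻¹ * a * b    ≈⟨ *-assoc a⁻¹ a b ⟩
    a⁻¹ * (a * b)  ≈⟨ *-congˡ ab≈0 ⟩
    a⁻¹ * 0#       ≈⟨ zeroʳ a⁻¹ ⟩
    0#             ∎

  x≉0∧y≉0⇒x*y≉0 : ∀ {a b} → ¬ (a ≈ 0#) → ¬ (b ≈ 0#) → ¬ (a * b ≈ 0#)
  x≉0∧y≉0⇒x*y≉0 a≉0 b≉0 = b≉0 ∘ x*y≈0⇒y≈0 a≉0

  x*y≈0⇒x≈0∨y≈0 : ∀ {a b} → a * b ≈ 0# → a ≈ 0# ⊎ b ≈ 0#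
  x*y≈0⇒x≈0∨y≈0 {a} ab≈0 with a ≟ 0#
  ... | yes a≈0 = inj₁ a≈0
  ... | no  a≉0 = inj₂ (x*y≈0⇒y≈0 a≉0 ab≈0)

  2·x≈0⇒x≈0 : ∀ {a} → 2 · a ≈ 0# → a ≈ 0#
  2·x≈0⇒x≈0 {a} 2a≈0 = x*y≈0⇒y≈0 1+1≉0 (trans (sym (2·x≈[1+1]*x a)) 2a≈0)

module _ (ℝ : RealField) where
  open RealField ℝ
  open Polys commRing
  open PolynomialIdentities commRing
  open OrderedFieldProperties ℝ
  open import Algebra.Properties.Ring (CommutativeRing.ring commRing) using (x∙y⁻¹≈ε⇒x≈y)

  real-solutions : ∀ (S m x y z : Carrier) →
    ¬ (S ≈ 0#) → ¬ (m ≈ 0#) → ¬ (x ≈ 0#) →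
    p₁ S m x y ≈ 0# → p₂ S m x y ≈ 0# →
    den S * z ≈ num S m x →
    (S ≈ x + z ^ 2) × (m * x ≈ q x z ^ 2) × ((y ≈ x - z) ⊎ (y * q x z ^ 2 ≈ y₂-numerator x z))
  real-solutions S m x y z S≉0 m≉0 x≉0 p₁≈0 p₂≈0 dz≈num = S≈x+z² , mx≈q² , y≈y₁∨y≈y₂
    where
    den≉0 : ¬ (den S ≈ 0#)
    den≉0 = S≉0 ∘ 2·x≈0⇒x≈0

    S≈x+z² : S ≈ x + z ^ 2
    S≈x+z² = sym (x∙y⁻¹≈ε⇒x≈y _ _ (x*y≈0⇒y≈0 (x≉0∧y≉0⇒x*y≉0 den≉0 den≉0)
      (trans (den²[x+z²-S]≈p₁ y dz≈num) p₁≈0)))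

    mx≈q² : m * x ≈ q x z ^ 2
    mx≈q² = m*x≈q² dz≈num S≈x+z²

    q²≉0 : ¬ (q x z ^ 2 ≈ 0#)
    q²≉0 = x≉0∧y≉0⇒x*y≉0 m≉0 x≉0 ∘ trans mx≈q²

    [y-y₁][yq²-y₂]≈0 : (y - (x - z)) * (y * q x z ^ 2 - y₂-numerator x z) ≈ 0#
    [y-y₁][yq²-y₂]≈0 = x*y≈0⇒y≈0 q²≉0 (2·x≈0⇒x≈0 (2·x≈0⇒x≈0
      (trans (sym (x²p₂≈4q²[y-y₁][yq²-y₂] y S≈x+z² mx≈q²)) (trans (*-congˡ p₂≈0) (zeroʳ _)))))

    y≈y₁∨y≈y₂ : (y ≈ x - z) ⊎ (y * q x z ^ 2 ≈ y₂-numerator x z)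
    y≈y₁∨y≈y₂ = Sum.map (x∙y⁻¹≈ε⇒x≈y _ _) (x∙y⁻¹≈ε⇒x≈y _ _) (x*y≈0⇒x≈0∨y≈0 [y-y₁][yq²-y₂]≈0)

open import Data.Integer.Divisibility using (_∣_)
open import Data.Integer.Divisibility.Signed using (∣⇒∣ᵤ; ∣m⇒∣m*n; ∣-refl)

module _ where
  open PolynomialIdentities +-*-commutativeRing using (num; p₁≈num²-den²[S-x]; 2·x≈[1+1]*x)
  open SquareDivisibility using (m*m∣n*n⇒m∣n)

  i*i∣j*j⇒i∣j : ∀ i j .{{_ : Z.NonZero i}} → i Z.* i ∣ j Z.* j → i ∣ j
  i*i∣j*j⇒i∣j i j = m*m∣n*n⇒m∣n Z.∣ i ∣ Z.∣ j ∣ ∘ ≡.subst₂ ℕ._∣_ (ZP.abs-* i i) (ZP.abs-* j j)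

  2S∣num : ∀ S m x y → ¬ (S ≡ 0ℤ) → Polys.p₁ +-*-commutativeRing S m x y ≡ 0ℤ → (+ 2 Z.* S) ∣ num S m x
  2S∣num S m x y S≢0 p₁≡0 = i*i∣j*j⇒i∣j 2S (num S m x)
    (≡.subst (2S Z.* 2S ∣_) (≡.sym num²≡[2S]²[S-x]) (∣⇒∣ᵤ (∣m⇒∣m*n (S Z.- x) (∣-refl {2S Z.* 2S}))))
    where
    2S : ℤ
    2S = + 2 Z.* S

    instance
      S≢0′ : Z.NonZero S
      S≢0′ = Z.≢-nonZero S≢0
      2S≢0 : Z.NonZero 2S
      2S≢0 = ZP.i*j≢0 (+ 2) S

    num²≡[2S]²[S-x] : num S m x Z.* num S m x ≡ 2S Z.* 2S Z.* (S Z.- x)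
    num²≡[2S]²[S-x] = ≡.trans (ZP.i-j≡0⇒i≡j _ _ (≡.trans (≡.sym (p₁≈num²-den²[S-x] S m x y)) p₁≡0))
      (≡.cong (λ d → d Z.* d Z.* (S Z.- x)) (2·x≈[1+1]*x S))

lemma3 :
  (∀ (ℝ : RealField) → let open RealField ℝ in let open Polys commRing in
    ∀ (S m x y z : Carrier) →
    ¬ (S ≈ 0#) → ¬ (m ≈ 0#) → ¬ (x ≈ 0#) →
    p₁ S m x y ≈ 0# → p₂ S m x y ≈ 0# →
    -- z = (x(m+1) - S(S+1)) / (2S), stated multiplied out by 2S
    (2 · S) * z ≈ x * (m + 1#) - S * (S + 1#) →
    (S ≈ x + z ^ 2)
    × (m * x ≈ (x + z ^ 2 + z) ^ 2)
    × ((y ≈ x - z)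
       ⊎ (y * (x + z ^ 2 + z) ^ 2
           ≈ x ^ 3 + 2 · (x ^ 2 * z ^ 2) + x ^ 2 * z + x * z ^ 4
             + 2 · (x * z ^ 3) + 3 · (x * z ^ 2)
             + z ^ 5 + 2 · (z ^ 4) + z ^ 3)))
  ×
  (∀ (S₀ m₀ x₀ y₀ : ℤ) →
    ¬ (S₀ ≡ 0ℤ) → ¬ (m₀ ≡ 0ℤ) → ¬ (x₀ ≡ 0ℤ) → ¬ (y₀ ≡ 0ℤ) →
    Polys.p₁ +-*-commutativeRing S₀ m₀ x₀ y₀ ≡ 0ℤ →
    Polys.p₂ +-*-commutativeRing S₀ m₀ x₀ y₀ ≡ 0ℤ →
    (+ 2 Z.* S₀) ∣ (x₀ Z.* (m₀ Z.+ 1ℤ) Z.- S₀ Z.* (S₀ Z.+ 1ℤ)))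
lemma3 = real-solutions , λ S₀ m₀ x₀ y₀ S₀≢0 _ _ _ p₁≡0 _ → 2S∣num S₀ m₀ x₀ y₀ S₀≢0 p₁≡0
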